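{- Let $a_1<a_2<\cdots<a_n$ be positive integers. Then $$\sum_{\substack{\pi\in\mathfrak{B}_{\{a_1,\dots,a_n\}}\\ \mathsf{pos}_{a_n}(\pi)\neq n}}(-1)^{\mathsf{inv}_B(\pi)}t^{\mathsf{des}_B(\pi)}s^{\mathsf{asc}_B(\pi)}u^{\mathsf{pos}_{a_n}(\pi)}=0.$$
   Context: $\mathfrak{B}_{\{a_1,\dots,a_n\}}$ is the set of $2^nn!$ bijections $\pi$ of $\{\pm a_1,\dots,\pm a_n\}$ with $\pi(-x)=-\pi(x)$; write $\pi_{a_i}=\pi(a_i)$, so $\pi$ is recorded by the word $\pi_{a_1},\dots,\pi_{a_n}$. Set $\pi_{a_0}=0$. Define $\mathsf{inv}_B(\pi)=|\{1\le i<j\le n:\pi_{a_i}>\pi_{a_j}\}|+|\{1\le i<j\le n:-\pi_{a_i}>\pi_{a_j}\}|+|\{i:\pi_{a_i}<0\}|$, $\mathsf{des}_B(\pi)=|\{i\in\{0,\dots,n-1\}:\pi_{a_i}>\pi_{a_{i+1}}\}|$, $\mathsf{asc}_B(\pi)=|\{i\in\{0,\dots,n-1\}:\pi_{a_i}<\pi_{a_{i+1}}\}|$, and $\mathsf{pos}_{a_n}(\pi)=k$ where $|\pi_{a_k}|=a_n$. -}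

module Defs where

open import Data.Nat as ℕ using (ℕ; zero; suc)
open import Data.Integer as ℤ using (ℤ; +_; -_; ∣_∣; 0ℤ; -1ℤ; _<?_)
open import Data.Fin using (Fin; fromℕ)
open import Data.Bool using (Bool; true; false; if_then_else_)
open import Data.List using (List; []; _∷_; [_]; map; _++_; concatMap; filter; tabulate; foldr)
import Data.Nat.Properties as ℕP
open import Data.List.Relation.Unary.Unique.DecSetoid (ℕP.≡-decSetoid) using (unique?)
open import Data.Product using (_×_; _,_)
open import Relation.Nullary using (does; ¬?)
open import Relation.Binary.PropositionalEquality using (_≡_)

-- Multivariate polynomials in t, s, u with integer coefficients, given
-- as a finite formal sum of monomials  c · t^d s^e u^k  (entries (c,d,e,k)).
-- Two such sums denote the same polynomial iff all coefficients agree.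

Monomial : Set
Monomial = ℤ × ℕ × ℕ × ℕ

Poly : Set
Poly = List Monomial

coeff : Poly → ℕ → ℕ → ℕ → ℤ
coeff [] d e k = 0ℤ
coeff ((c , d' , e' , k') ∷ p) d e k =
  (if does (d ℕ.≟ d') Data.Bool.∧ does (e ℕ.≟ e') Data.Bool.∧ does (k ℕ.≟ k')
   then c else 0ℤ) ℤ.+ coeff p d e k

-- Signed permutations of {a_1,...,a_n}, recorded by their word
-- π_{a_1} ... π_{a_n} (a list of integers).

aList : ∀ {n} → (Fin n → ℕ) → List ℕ
aList a = tabulate a

candidates : ∀ {n} → (Fin n → ℕ) → List ℤ
candidates a = map +_ (aList a) ++ map (λ x → - (+ x)) (aList a)

words : List ℤ → ℕ → List (List ℤ)
words cs zero = [ [] ]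
words cs (suc k) = concatMap (λ c → map (c ∷_) (words cs k)) cs

-- 𝔅_{a_1..a_n}: words of length n over {±a_i} whose absolute values are
-- pairwise distinct, i.e. |π_{a_1}|,...,|π_{a_n}| is a permutation of
-- a_1,...,a_n (a_i distinct); π(-x) = -π(x) extends it to {±a_i}.
signedPerms : ∀ n → (Fin n → ℕ) → List (List ℤ)
signedPerms n a = filter (λ w → unique? (map ∣_∣ w)) (words (candidates a) n)

count : (ℤ → Bool) → List ℤ → ℕ
count p [] = 0
count p (x ∷ xs) = (if p x then 1 else 0) ℕ.+ count p xs

pairCount : (ℤ → ℤ → Bool) → List ℤ → ℕ
pairCount R [] = 0
pairCount R (x ∷ xs) = count (R x) xs ℕ.+ pairCount R xs

adjCount : (ℤ → ℤ → Bool) → List ℤ → ℕ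
adjCount R [] = 0
adjCount R (x ∷ []) = 0
adjCount R (x ∷ y ∷ ys) = (if R x y then 1 else 0) ℕ.+ adjCount R (y ∷ ys)

_>ᵇ_ : ℤ → ℤ → Bool
x >ᵇ y = does (y <? x)

_<ᵇ_ : ℤ → ℤ → Bool
x <ᵇ y = does (x <? y)

invB : List ℤ → ℕ
invB w = pairCount (λ x y → x >ᵇ y) w
         ℕ.+ pairCount (λ x y → (- x) >ᵇ y) w
         ℕ.+ count (λ x → x <ᵇ 0ℤ) w

-- des_B, asc_B (with π_{a_0} = 0)
desB : List ℤ → ℕ
desB w = adjCount _>ᵇ_ (0ℤ ∷ w)

ascB : List ℤ → ℕ
ascB w = adjCount _<ᵇ_ (0ℤ ∷ w)

posOf : ℕ → List ℤ → ℕ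
posOf m [] = 0
posOf m (x ∷ xs) = if does (∣ x ∣ ℕ.≟ m) then 1 else suc (posOf m xs)

posLast : ∀ {m} → (Fin (suc m) → ℕ) → List ℤ → ℕ
posLast {m} a w = posOf (a (fromℕ m)) w

lemma26Poly : ∀ m → (Fin (suc m) → ℕ) → Poly
lemma26Poly m a =
  map (λ w → (-1ℤ ℤ.^ invB w , desB w , ascB w , posLast a w))
      (filter (λ w → ¬? (posLast a w ℕ.≟ suc m)) (signedPerms (suc m) a))

-- Let aₙ sit at a position before the end of π, and let μ be the smallest
-- absolute value among the letters to the right of aₙ. Changing the sign of
-- the letter ±μ is an involution on the summation range (μ is read off the
-- absolute values only, which the change preserves). It fixes pos_{aₙ}, and
-- since both neighbours of ±μ have larger absolute value, no comparison of
-- adjacent letters (or with π_{a_0} = 0) changes, so des_B and asc_B are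
-- fixed too. Modulo 2, [x > y] + [-x > y] equals [|x| > |y|], so inv_B is
-- congruent to the number of absolute-value inversions plus the number of
-- negative letters; the former is unchanged and the latter changes by one.
-- Hence the involution reverses every sign and the sum vanishes.
module Submission where

open import Defs
open import Data.Bool using (Bool; true; false; not; if_then_else_; _∧_)
open import Data.Empty using (⊥-elim)
open import Data.Fin using (Fin; fromℕ) renaming (_<_ to _<ᶠ_)
import Data.Fin.Properties as FinP
open import Data.Integer as ℤ
  using (ℤ; +_; +0; +[1+_]; -[1+_]; -_; ∣_∣; 0ℤ; -1ℤ; _<?_; _◃_; +<+; -<+; -<-)
import Data.Integer.Properties as ℤP
open import Data.List using (List; []; _∷_; map; _++_; length; drop; filter; concatMap)
import Data.List.Properties as ListP
open import Data.List.Extrema.Nat using (min; min≤xs; min≤⊤; argmin-sel)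
open import Data.List.Membership.Propositional using (_∈_; find; lose)
open import Data.List.Membership.Propositional.Properties
  using (∈-map⁺; ∈-map⁻; ∈-++⁺ˡ; ∈-++⁺ʳ; ∈-++⁻; ∈-concatMap⁺; ∈-concatMap⁻; ∈-tabulate⁻; ∈-filter⁺; ∈-filter⁻)
open import Data.List.Relation.Unary.All as All using (All; []; _∷_)
import Data.List.Relation.Unary.All.Properties as AllP
open import Data.List.Relation.Unary.AllPairs as AllPairs using (AllPairs; []; _∷_)
import Data.List.Relation.Unary.AllPairs.Properties as AllPairsP
open import Data.List.Relation.Unary.Any using (here; there)
open import Data.List.Relation.Unary.Linked as Linked using (Linked; []; [-]; _∷_)
open import Data.List.Relation.Unary.Unique.Propositional using (Unique)
import Data.List.Relation.Unary.Unique.Propositional.Properties as UniqueP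
open import Data.Nat as ℕ using (ℕ; zero; suc; _+_; _<_; _≤_; s≤s; parity)
import Data.Nat.Properties as ℕP
open import Data.List.Relation.Unary.Unique.DecSetoid ℕP.≡-decSetoid using (unique?)
open import Algebra.Properties.CommutativeSemigroup ℕP.+-commutativeSemigroup using (interchange)
open import Data.Parity.Base as ℙ using (0ℙ; 1ℙ; _⁻¹; toSign)
open import Data.Parity.Properties using (+-homo-+; suc-homo-⁻¹; ⁻¹-involutive)
open import Data.Product using (_×_; _,_; proj₁; proj₂; ∃)
open import Data.Sum using (_⊎_; inj₁; inj₂)
open import Function using (_∘_)
open import Relation.Binary.Definitions using (DecidableEquality; tri<; tri≈; tri>)
open import Relation.Binary.PropositionalEquality
  using (_≡_; _≢_; refl; sym; trans; cong; cong₂; subst; module ≡-Reasoning)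
open import Relation.Nullary using (does; yes; no; ¬_; ¬?)
open import Relation.Nullary.Decidable using (dec-true; dec-false)

open ≡-Reasoning

bit : Bool → ℕ
bit b = if b then 1 else 0

parity-suc : ∀ n → parity (suc n) ≡ parity n ⁻¹
parity-suc n = sym (suc-homo-⁻¹ (suc n))

parity-not : ∀ b n → parity (bit (not b) + n) ≡ parity (bit b + n) ⁻¹
parity-not false n = parity-suc n
parity-not true n = sym (trans (cong _⁻¹ (parity-suc n)) (⁻¹-involutive (parity n)))

parity-bit-+ : ∀ b {m n} → parity m ≡ parity n ⁻¹ → parity (bit b + m) ≡ parity (bit b + n) ⁻¹
parity-bit-+ false eq = eq
parity-bit-+ true {m} {n} eq = begin
  parity (suc m)     ≡⟨ parity-suc m ⟩
  parity m ⁻¹        ≡⟨ cong _⁻¹ eq ⟩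
  parity n ⁻¹ ⁻¹     ≡⟨ cong _⁻¹ (parity-suc n) ⟨
  parity (suc n) ⁻¹  ∎

parity-+-interchange : ∀ {a b c a′ b′ c′} → parity (a + b) ≡ parity c → parity (a′ + b′) ≡ parity c′ →
                       parity ((a + a′) + (b + b′)) ≡ parity (c + c′)
parity-+-interchange {a} {b} {c} {a′} {b′} {c′} eq eq′ = begin
  parity ((a + a′) + (b + b′))         ≡⟨ cong parity (interchange a a′ b b′) ⟩
  parity ((a + b) + (a′ + b′))         ≡⟨ +-homo-+ (a + b) (a′ + b′) ⟩
  parity (a + b) ℙ.+ parity (a′ + b′)  ≡⟨ cong₂ ℙ._+_ eq eq′ ⟩
  parity c ℙ.+ parity c′               ≡⟨ +-homo-+ c c′ ⟨
  parity (c + c′)                      ∎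

parity-count-+ : ∀ p q r xs → All (λ x → parity (bit (p x) + bit (q x)) ≡ parity (bit (r x))) xs →
                 parity (count p xs + count q xs) ≡ parity (count r xs)
parity-count-+ p q r [] [] = refl
parity-count-+ p q r (x ∷ xs) (eq ∷ eqs) =
  parity-+-interchange {bit (p x)} {bit (q x)} {bit (r x)} {count p xs} {count q xs} {count r xs}
    eq (parity-count-+ p q r xs eqs)

parity-pairCount-+ : ∀ R S T xs →
                     AllPairs (λ x y → parity (bit (R x y) + bit (S x y)) ≡ parity (bit (T x y))) xs →
                     parity (pairCount R xs + pairCount S xs) ≡ parity (pairCount T xs)
parity-pairCount-+ R S T [] [] = refl
parity-pairCount-+ R S T (x ∷ xs) (eqs ∷ eqss) =
  parity-+-interchange {count (R x) xs} {count (S x) xs} {count (T x) xs}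
                       {pairCount R xs} {pairCount S xs} {pairCount T xs}
    (parity-count-+ (R x) (S x) (T x) xs eqs) (parity-pairCount-+ R S T xs eqss)

-1^≡toSign◃1 : ∀ n → -1ℤ ℤ.^ n ≡ toSign (parity n) ◃ 1
-1^≡toSign◃1 zero = refl
-1^≡toSign◃1 (suc n) = begin
  -1ℤ ℤ.* -1ℤ ℤ.^ n             ≡⟨ ℤP.-1*i≡-i (-1ℤ ℤ.^ n) ⟩
  - (-1ℤ ℤ.^ n)                 ≡⟨ cong -_ (-1^≡toSign◃1 n) ⟩
  - (toSign (parity n) ◃ 1)     ≡⟨ neg-toSign◃1 (parity n) ⟩
  toSign (parity n ⁻¹) ◃ 1      ≡⟨ cong (λ p → toSign p ◃ 1) (parity-suc n) ⟨
  toSign (parity (suc n)) ◃ 1   ∎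
  where
  neg-toSign◃1 : ∀ p → - (toSign p ◃ 1) ≡ toSign (p ⁻¹) ◃ 1
  neg-toSign◃1 0ℙ = refl
  neg-toSign◃1 1ℙ = refl

-1^-opposite : ∀ m n → parity m ≡ parity n ⁻¹ → -1ℤ ℤ.^ m ≡ - (-1ℤ ℤ.^ n)
-1^-opposite m n eq = begin
  -1ℤ ℤ.^ m                    ≡⟨ -1^≡toSign◃1 m ⟩
  toSign (parity m) ◃ 1        ≡⟨ cong (λ p → toSign p ◃ 1) (trans eq (sym (parity-suc n))) ⟩
  toSign (parity (suc n)) ◃ 1  ≡⟨ -1^≡toSign◃1 (suc n) ⟨
  -1ℤ ℤ.* -1ℤ ℤ.^ n            ≡⟨ ℤP.-1*i≡-i (-1ℤ ℤ.^ n) ⟩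
  - (-1ℤ ℤ.^ n)                ∎

∣∣<∣∣⇒same-side-as-0 : ∀ {y z} → ∣ y ∣ < ∣ z ∣ → (y ℤ.< z × 0ℤ ℤ.< z) ⊎ (z ℤ.< y × z ℤ.< 0ℤ)
∣∣<∣∣⇒same-side-as-0 {+ k}      {+[1+ n ]} lt       = inj₁ (+<+ lt , +<+ (s≤s ℕ.z≤n))
∣∣<∣∣⇒same-side-as-0 { -[1+ k ]} {+[1+ n ]} _        = inj₁ (-<+ , +<+ (s≤s ℕ.z≤n))
∣∣<∣∣⇒same-side-as-0 {+ k}      { -[1+ n ]} _        = inj₂ (-<+ , -<+)
∣∣<∣∣⇒same-side-as-0 { -[1+ k ]} { -[1+ n ]} (s≤s lt) = inj₂ (-<- lt , -<+)

<?-by-sign : ∀ y z → ∣ y ∣ < ∣ z ∣ → does (y <? z) ≡ does (0ℤ <? z)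
<?-by-sign y z lt with ∣∣<∣∣⇒same-side-as-0 lt
... | inj₁ (y<z , 0<z) = trans (dec-true (y <? z) y<z) (sym (dec-true (0ℤ <? z) 0<z))
... | inj₂ (z<y , z<0) =
  trans (dec-false (y <? z) (ℤP.<-asym z<y)) (sym (dec-false (0ℤ <? z) (ℤP.<-asym z<0)))

>?-by-sign : ∀ y z → ∣ y ∣ < ∣ z ∣ → does (z <? y) ≡ does (z <? 0ℤ)
>?-by-sign y z lt with ∣∣<∣∣⇒same-side-as-0 lt
... | inj₁ (y<z , 0<z) =
  trans (dec-false (z <? y) (ℤP.<-asym y<z)) (sym (dec-false (z <? 0ℤ) (ℤP.<-asym 0<z)))
... | inj₂ (z<y , z<0) = trans (dec-true (z <? y) z<y) (sym (dec-true (z <? 0ℤ) z<0))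

∣-∣<-∣∣ : ∀ {y z} → ∣ y ∣ < ∣ z ∣ → ∣ - y ∣ < ∣ z ∣
∣-∣<-∣∣ {y} {z} = subst (_< ∣ z ∣) (sym (ℤP.∣-i∣≡∣i∣ y))

absGreater : ℤ → ℤ → Bool
absGreater x y = does (∣ y ∣ ℕ.<? ∣ x ∣)

-- Modulo 2, x and -x together exceed y once if |x| > |y|, and twice or never if |x| < |y|.
parity-inversion-pair : ∀ x y → ∣ x ∣ ≢ ∣ y ∣ →
                        parity (bit (x >ᵇ y) + bit ((- x) >ᵇ y)) ≡ parity (bit (absGreater x y))
parity-inversion-pair x y x≢y with ℕP.<-cmp ∣ x ∣ ∣ y ∣
... | tri≈ _ eq _ = ⊥-elim (x≢y eq)
... | tri< x<y _ _ = begin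
  parity (bit (does (y <? x)) + bit (does (y <? - x)))
    ≡⟨ cong₂ (λ b c → parity (bit b + bit c))
             (>?-by-sign x y x<y) (>?-by-sign (- x) y (∣-∣<-∣∣ {x} {y} x<y)) ⟩
  parity (bit (does (y <? 0ℤ)) + bit (does (y <? 0ℤ)))
    ≡⟨ parity-double (does (y <? 0ℤ)) ⟩
  0ℙ
    ≡⟨ cong (parity ∘ bit) (dec-false (∣ y ∣ ℕ.<? ∣ x ∣) (ℕP.<-asym x<y)) ⟨
  parity (bit (absGreater x y)) ∎
  where
  parity-double : ∀ b → parity (bit b + bit b) ≡ 0ℙ
  parity-double false = refl
  parity-double true = refl
... | tri> _ _ y<x = begin
  parity (bit (does (y <? x)) + bit (does (y <? - x)))
    ≡⟨ cong₂ (λ b c → parity (bit b + bit c))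
             (<?-by-sign y x y<x) (<?-by-sign y (- x) (subst (∣ y ∣ <_) (sym (ℤP.∣-i∣≡∣i∣ x)) y<x)) ⟩
  parity (bit (does (0ℤ <? x)) + bit (does (0ℤ <? - x)))
    ≡⟨ one-of-±-positive x y<x ⟩
  1ℙ
    ≡⟨ cong (parity ∘ bit) (dec-true (∣ y ∣ ℕ.<? ∣ x ∣) y<x) ⟨
  parity (bit (absGreater x y)) ∎
  where
  one-of-±-positive : ∀ {k} x → k < ∣ x ∣ → parity (bit (does (0ℤ <? x)) + bit (does (0ℤ <? - x))) ≡ 1ℙ
  one-of-±-positive +[1+ n ] _ = refl
  one-of-±-positive -[1+ n ] _ = refl

toggle : ℕ → ℤ → ℤ
toggle k y = if does (∣ y ∣ ℕ.≟ k) then - y else y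

toggle-≡ : ∀ {k} y → ∣ y ∣ ≡ k → toggle k y ≡ - y
toggle-≡ {k} y eq rewrite dec-true (∣ y ∣ ℕ.≟ k) eq = refl

toggle-≢ : ∀ {k} y → ∣ y ∣ ≢ k → toggle k y ≡ y
toggle-≢ {k} y ne rewrite dec-false (∣ y ∣ ℕ.≟ k) ne = refl

∣toggle∣ : ∀ k y → ∣ toggle k y ∣ ≡ ∣ y ∣
∣toggle∣ k y with ∣ y ∣ ℕ.≟ k
... | yes y≡k = trans (cong ∣_∣ (toggle-≡ y y≡k)) (ℤP.∣-i∣≡∣i∣ y)
... | no y≢k = cong ∣_∣ (toggle-≢ y y≢k)

toggle-involutive : ∀ k y → toggle k (toggle k y) ≡ y
toggle-involutive k y with ∣ y ∣ ℕ.≟ k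
... | yes y≡k = begin
  toggle k (toggle k y)  ≡⟨ cong (toggle k) (toggle-≡ y y≡k) ⟩
  toggle k (- y)         ≡⟨ toggle-≡ (- y) (trans (ℤP.∣-i∣≡∣i∣ y) y≡k) ⟩
  - - y                  ≡⟨ ℤP.neg-involutive y ⟩
  y                      ∎
... | no y≢k = trans (cong (toggle k) (toggle-≢ y y≢k)) (toggle-≢ y y≢k)

toggle-0 : ∀ k → toggle k 0ℤ ≡ 0ℤ
toggle-0 k with 0 ℕ.≟ k
... | yes 0≡k = toggle-≡ 0ℤ 0≡k
... | no 0≢k = toggle-≢ 0ℤ 0≢k

map-toggle-involutive : ∀ k xs → map (toggle k) (map (toggle k) xs) ≡ xs
map-toggle-involutive k [] = refl
map-toggle-involutive k (x ∷ xs) = cong₂ _∷_ (toggle-involutive k x) (map-toggle-involutive k xs)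

map-∣∣-toggle : ∀ k xs → map ∣_∣ (map (toggle k) xs) ≡ map ∣_∣ xs
map-∣∣-toggle k [] = refl
map-∣∣-toggle k (x ∷ xs) = cong₂ _∷_ (∣toggle∣ k x) (map-∣∣-toggle k xs)

posOf-toggle : ∀ k M xs → posOf M (map (toggle k) xs) ≡ posOf M xs
posOf-toggle k M [] = refl
posOf-toggle k M (x ∷ xs) =
  cong₂ (λ n r → if does (n ℕ.≟ M) then 1 else suc r) (∣toggle∣ k x) (posOf-toggle k M xs)

record Stable (k : ℕ) (y z : ℤ) : Set where
  constructor stable
  field
    left  : ∣ y ∣ ≡ k → k < ∣ z ∣
    right : ∣ z ∣ ≡ k → k < ∣ y ∣

stable-sym : ∀ {k y z} → Stable k y z → Stable k z y
stable-sym (stable left right) = stable right left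

toggle-<?-stable : ∀ {k y z} → Stable k y z → does (toggle k y <? toggle k z) ≡ does (y <? z)
toggle-<?-stable {k} {y} {z} (stable y≡k⇒ z≡k⇒) with ∣ y ∣ ℕ.≟ k | ∣ z ∣ ℕ.≟ k
... | yes y≡k | yes z≡k = ⊥-elim (ℕP.<-irrefl (sym z≡k) (y≡k⇒ y≡k))
... | yes y≡k | no z≢k = begin
  does (toggle k y <? toggle k z)  ≡⟨ cong₂ (λ u v → does (u <? v)) (toggle-≡ y y≡k) (toggle-≢ z z≢k) ⟩
  does (- y <? z)                  ≡⟨ <?-by-sign (- y) z (∣-∣<-∣∣ {y} {z} y<z) ⟩
  does (0ℤ <? z)                   ≡⟨ <?-by-sign y z y<z ⟨
  does (y <? z)                    ∎
  where
  y<z : ∣ y ∣ < ∣ z ∣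
  y<z = subst (_< ∣ z ∣) (sym y≡k) (y≡k⇒ y≡k)
... | no y≢k | yes z≡k = begin
  does (toggle k y <? toggle k z)  ≡⟨ cong₂ (λ u v → does (u <? v)) (toggle-≢ y y≢k) (toggle-≡ z z≡k) ⟩
  does (y <? - z)                  ≡⟨ >?-by-sign (- z) y (∣-∣<-∣∣ {z} {y} z<y) ⟩
  does (y <? 0ℤ)                   ≡⟨ >?-by-sign z y z<y ⟨
  does (y <? z)                    ∎
  where
  z<y : ∣ z ∣ < ∣ y ∣
  z<y = subst (_< ∣ y ∣) (sym z≡k) (z≡k⇒ z≡k)
... | no y≢k | no z≢k = cong₂ (λ u v → does (u <? v)) (toggle-≢ y y≢k) (toggle-≢ z z≢k)

stable-away : ∀ {k y z} → ∣ y ∣ ≢ k → ∣ z ∣ ≢ k → Stable k y z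
stable-away y≢k z≢k = stable (λ y≡k → ⊥-elim (y≢k y≡k)) (λ z≡k → ⊥-elim (z≢k z≡k))

stable-above : ∀ {k xs} → All (λ y → k ≤ ∣ y ∣) xs → AllPairs (λ y z → ∣ y ∣ ≢ ∣ z ∣) xs →
               Linked (Stable k) xs
stable-above [] _ = []
stable-above (_ ∷ []) _ = [-]
stable-above (k≤y ∷ k≤z ∷ k≤zs) ((y≢z ∷ _) ∷ distinct) =
  stable (λ y≡k → ℕP.≤∧≢⇒< k≤z (λ k≡z → y≢z (trans y≡k k≡z)))
         (λ z≡k → ℕP.≤∧≢⇒< k≤y (λ k≡y → y≢z (trans (sym k≡y) (sym z≡k))))
  ∷ stable-above (k≤z ∷ k≤zs) distinct

stable-++ : ∀ {k ys x zs} → All (λ y → ∣ y ∣ ≢ k) ys → ∣ x ∣ ≢ k →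
            Linked (Stable k) (x ∷ zs) → Linked (Stable k) (ys ++ x ∷ zs)
stable-++ [] _ st = st
stable-++ (y≢k ∷ []) x≢k st = stable-away y≢k x≢k ∷ st
stable-++ (y≢k ∷ y′≢k ∷ ys≢k) x≢k st = stable-away y≢k y′≢k ∷ stable-++ (y′≢k ∷ ys≢k) x≢k st

adjCount-map : ∀ R {h : ℤ → ℤ} {xs} → Linked (λ y z → R (h y) (h z) ≡ R y z) xs →
               adjCount R (map h xs) ≡ adjCount R xs
adjCount-map R [] = refl
adjCount-map R [-] = refl
adjCount-map R (eq ∷ eqs) = cong₂ (λ b n → bit b + n) eq (adjCount-map R eqs)

adjCount-toggle : ∀ R {k} w → (∀ {y z} → Stable k y z → R (toggle k y) (toggle k z) ≡ R y z) →
                  Linked (Stable k) (0ℤ ∷ w) → adjCount R (0ℤ ∷ map (toggle k) w) ≡ adjCount R (0ℤ ∷ w)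
adjCount-toggle R {k} w R-stable st = begin
  adjCount R (0ℤ ∷ map (toggle k) w)      ≡⟨ cong (λ z → adjCount R (z ∷ map (toggle k) w)) (toggle-0 k) ⟨
  adjCount R (map (toggle k) (0ℤ ∷ w))    ≡⟨ adjCount-map R (Linked.map R-stable st) ⟩
  adjCount R (0ℤ ∷ w)                     ∎

desB-toggle : ∀ {k} w → Linked (Stable k) (0ℤ ∷ w) → desB (map (toggle k) w) ≡ desB w
desB-toggle w = adjCount-toggle _>ᵇ_ w (toggle-<?-stable ∘ stable-sym)

ascB-toggle : ∀ {k} w → Linked (Stable k) (0ℤ ∷ w) → ascB (map (toggle k) w) ≡ ascB w
ascB-toggle w = adjCount-toggle _<ᵇ_ w toggle-<?-stable

pairCount-map : ∀ R {h : ℤ → ℤ} → (∀ y z → R (h y) (h z) ≡ R y z) → ∀ xs →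
                pairCount R (map h xs) ≡ pairCount R xs
pairCount-map R {h} R-inv [] = refl
pairCount-map R {h} R-inv (x ∷ xs) = cong₂ _+_ (count-map xs) (pairCount-map R R-inv xs)
  where
  count-map : ∀ ys → count (R (h x)) (map h ys) ≡ count (R x) ys
  count-map [] = refl
  count-map (y ∷ ys) = cong₂ (λ b n → bit b + n) (R-inv x y) (count-map ys)

inversionPairs : List ℤ → ℕ
inversionPairs w = pairCount (λ x y → x >ᵇ y) w + pairCount (λ x y → (- x) >ᵇ y) w

parity-inversionPairs : ∀ w → Unique (map ∣_∣ w) →
                        parity (inversionPairs w) ≡ parity (pairCount absGreater w)
parity-inversionPairs w distinct =
  parity-pairCount-+ _ _ absGreater w
    (AllPairs.map (λ {x} {y} → parity-inversion-pair x y) (AllPairsP.map⁻ distinct))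

neg-<ᵇ0 : ∀ {y} → y ≢ 0ℤ → (- y) <ᵇ 0ℤ ≡ not (y <ᵇ 0ℤ)
neg-<ᵇ0 {+0} y≢0 = ⊥-elim (y≢0 refl)
neg-<ᵇ0 {+[1+ n ]} _ = refl
neg-<ᵇ0 { -[1+ n ]} _ = refl

parity-negatives-toggle : ∀ {k} xs → k ≢ 0 → Unique (map ∣_∣ xs) → k ∈ map ∣_∣ xs →
                          parity (count (_<ᵇ 0ℤ) (map (toggle k) xs)) ≡ parity (count (_<ᵇ 0ℤ) xs) ⁻¹
parity-negatives-toggle {k} (y ∷ ys) k≢0 (y∉ys ∷ _) (here k≡y) = begin
  parity (bit (toggle k y <ᵇ 0ℤ) + count (_<ᵇ 0ℤ) (map (toggle k) ys))
    ≡⟨ cong₂ (λ z zs → parity (bit (z <ᵇ 0ℤ) + count (_<ᵇ 0ℤ) zs))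
             (toggle-≡ y (sym k≡y)) (ListP.map-id-local (All.map (toggle-≢ _) ys≢k)) ⟩
  parity (bit ((- y) <ᵇ 0ℤ) + count (_<ᵇ 0ℤ) ys)
    ≡⟨ cong (λ b → parity (bit b + count (_<ᵇ 0ℤ) ys)) (neg-<ᵇ0 y≢0) ⟩
  parity (bit (not (y <ᵇ 0ℤ)) + count (_<ᵇ 0ℤ) ys)
    ≡⟨ parity-not (y <ᵇ 0ℤ) (count (_<ᵇ 0ℤ) ys) ⟩
  parity (bit (y <ᵇ 0ℤ) + count (_<ᵇ 0ℤ) ys) ⁻¹ ∎
  where
  ys≢k : All (λ z → ∣ z ∣ ≢ k) ys
  ys≢k = All.map (λ y≢z z≡k → y≢z (trans (sym k≡y) (sym z≡k))) (AllP.map⁻ y∉ys)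
  y≢0 : y ≢ 0ℤ
  y≢0 y≡0 = k≢0 (trans k≡y (cong ∣_∣ y≡0))
parity-negatives-toggle {k} (y ∷ ys) k≢0 (y∉ys ∷ distinct) (there k∈ys) = begin
  parity (bit (toggle k y <ᵇ 0ℤ) + count (_<ᵇ 0ℤ) (map (toggle k) ys))
    ≡⟨ cong (λ z → parity (bit (z <ᵇ 0ℤ) + count (_<ᵇ 0ℤ) (map (toggle k) ys)))
            (toggle-≢ y (All.lookup y∉ys k∈ys)) ⟩
  parity (bit (y <ᵇ 0ℤ) + count (_<ᵇ 0ℤ) (map (toggle k) ys))
    ≡⟨ parity-bit-+ (y <ᵇ 0ℤ) (parity-negatives-toggle ys k≢0 distinct k∈ys) ⟩
  parity (bit (y <ᵇ 0ℤ) + count (_<ᵇ 0ℤ) ys) ⁻¹ ∎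

parity-invB-toggle : ∀ {k} w → k ≢ 0 → Unique (map ∣_∣ w) → k ∈ map ∣_∣ w →
                     parity (invB (map (toggle k) w)) ≡ parity (invB w) ⁻¹
parity-invB-toggle {k} w k≢0 distinct k∈w = begin
  parity (inversionPairs w′ + negatives w′)         ≡⟨ +-homo-+ (inversionPairs w′) (negatives w′) ⟩
  parity (inversionPairs w′) ℙ.+ parity (negatives w′)
    ≡⟨ cong₂ ℙ._+_ inversionPairs-toggle (parity-negatives-toggle w k≢0 distinct k∈w) ⟩
  parity (inversionPairs w) ℙ.+ parity (negatives w) ⁻¹
    ≡⟨ +-⁻¹ (parity (inversionPairs w)) (parity (negatives w)) ⟩
  (parity (inversionPairs w) ℙ.+ parity (negatives w)) ⁻¹
    ≡⟨ cong _⁻¹ (+-homo-+ (inversionPairs w) (negatives w)) ⟨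
  parity (invB w) ⁻¹                                ∎
  where
  w′ : List ℤ
  w′ = map (toggle k) w
  negatives : List ℤ → ℕ
  negatives = count (_<ᵇ 0ℤ)
  +-⁻¹ : ∀ p q → p ℙ.+ q ⁻¹ ≡ (p ℙ.+ q) ⁻¹
  +-⁻¹ 0ℙ q = refl
  +-⁻¹ 1ℙ q = refl
  inversionPairs-toggle : parity (inversionPairs w′) ≡ parity (inversionPairs w)
  inversionPairs-toggle = begin
    parity (inversionPairs w′)         ≡⟨ parity-inversionPairs w′ (subst Unique (sym (map-∣∣-toggle k w)) distinct) ⟩
    parity (pairCount absGreater w′)   ≡⟨ cong parity (pairCount-map absGreater absGreater-toggle w) ⟩
    parity (pairCount absGreater w)    ≡⟨ parity-inversionPairs w distinct ⟨
    parity (inversionPairs w)          ∎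
    where
    absGreater-toggle : ∀ y z → absGreater (toggle k y) (toggle k z) ≡ absGreater y z
    absGreater-toggle y z = cong₂ (λ m n → does (n ℕ.<? m)) (∣toggle∣ k y) (∣toggle∣ k z)

sumℤ : {A : Set} → (A → ℤ) → List A → ℤ
sumℤ g [] = 0ℤ
sumℤ g (x ∷ xs) = g x ℤ.+ sumℤ g xs

module _ {A : Set} (_≟_ : DecidableEquality A) (f : A → A) (f-involutive : ∀ x → f (f x) ≡ x)
         (g : A → ℤ) where

  private
    Closed : List A → Set
    Closed xs = ∀ {x} → x ∈ xs → f x ∈ xs

    SignReversing : List A → Set
    SignReversing xs = ∀ {x} → x ∈ xs → g (f x) ≡ - g x

    without : A → List A → List A
    without v = filter (λ z → ¬? (z ≟ v))

    f-injective : ∀ {x y} → f x ≡ f y → x ≡ y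
    f-injective {x} {y} eq = trans (sym (f-involutive x)) (trans (cong f eq) (f-involutive y))

    i≡-i⇒i≡0 : ∀ {i} → i ≡ - i → i ≡ 0ℤ
    i≡-i⇒i≡0 {+0} _ = refl
    i≡-i⇒i≡0 {+[1+ n ]} ()
    i≡-i⇒i≡0 { -[1+ n ]} ()

  sumℤ-without : ∀ {v xs} → Unique xs → v ∈ xs → sumℤ g xs ≡ g v ℤ.+ sumℤ g (without v xs)
  sumℤ-without {v} {y ∷ ys} (y∉ys ∷ _) (here refl)
    rewrite ListP.filter-reject (λ z → ¬? (z ≟ v)) {y} {ys} (λ ¬y≢y → ¬y≢y refl) =
    cong (λ zs → g y ℤ.+ sumℤ g zs)
         (sym (ListP.filter-all (λ z → ¬? (z ≟ v)) (All.map (λ y≢z z≡y → y≢z (sym z≡y)) y∉ys)))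
  sumℤ-without {v} {y ∷ ys} (y∉ys ∷ distinct) (there v∈ys)
    rewrite ListP.filter-accept (λ z → ¬? (z ≟ v)) {y} {ys} (All.lookup y∉ys v∈ys) = begin
    g y ℤ.+ sumℤ g ys                           ≡⟨ cong (λ t → g y ℤ.+ t) (sumℤ-without distinct v∈ys) ⟩
    g y ℤ.+ (g v ℤ.+ sumℤ g (without v ys))     ≡⟨ ℤP.+-assoc (g y) (g v) _ ⟨
    (g y ℤ.+ g v) ℤ.+ sumℤ g (without v ys)     ≡⟨ cong (λ t → t ℤ.+ sumℤ g (without v ys)) (ℤP.+-comm (g y) (g v)) ⟩
    (g v ℤ.+ g y) ℤ.+ sumℤ g (without v ys)     ≡⟨ ℤP.+-assoc (g v) (g y) _ ⟩
    g v ℤ.+ (g y ℤ.+ sumℤ g (without v ys))     ∎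

  private
    closed-tail : ∀ {x ys} → All (x ≢_) ys → f x ≡ x → Closed (x ∷ ys) → Closed ys
    closed-tail x∉ys fx≡x closed {y} y∈ys with closed (there y∈ys)
    ... | here fy≡x = ⊥-elim (All.lookup x∉ys y∈ys (f-injective (trans fx≡x (sym fy≡x))))
    ... | there fy∈ys = fy∈ys

    closed-without : ∀ {x ys} → All (x ≢_) ys → Closed (x ∷ ys) → Closed (without (f x) ys)
    closed-without {x} {ys} x∉ys closed {y} y∈zs with ∈-filter⁻ (λ z → ¬? (z ≟ f x)) {xs = ys} y∈zs
    ... | y∈ys , y≢fx with closed (there y∈ys)
    ... | here fy≡x = ⊥-elim (y≢fx (trans (sym (f-involutive y)) (cong f fy≡x)))
    ... | there fy∈ys = ∈-filter⁺ (λ z → ¬? (z ≟ f x)) fy∈ys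
                          (λ fy≡fx → All.lookup x∉ys y∈ys (sym (f-injective fy≡fx)))

    sumℤ-involution-≤ : ∀ n xs → length xs ≤ n → Unique xs → Closed xs → SignReversing xs → sumℤ g xs ≡ 0ℤ
    sumℤ-involution-≤ _ [] _ _ _ _ = refl
    sumℤ-involution-≤ (suc n) (x ∷ ys) (s≤s len) (x∉ys ∷ distinct) closed reversing with f x ≟ x
    ... | yes fx≡x =
      cong₂ ℤ._+_ (i≡-i⇒i≡0 (trans (cong g (sym fx≡x)) (reversing (here refl))))
                  (sumℤ-involution-≤ n ys len distinct (closed-tail x∉ys fx≡x closed) (reversing ∘ there))
    ... | no fx≢x = begin
      g x ℤ.+ sumℤ g ys                ≡⟨ cong (λ t → g x ℤ.+ t) (sumℤ-without distinct fx∈ys) ⟩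
      g x ℤ.+ (g (f x) ℤ.+ sumℤ g zs)  ≡⟨ cong₂ (λ t u → g x ℤ.+ (t ℤ.+ u)) (reversing (here refl)) sum-zs≡0 ⟩
      g x ℤ.+ (- g x ℤ.+ 0ℤ)           ≡⟨ cong (λ t → g x ℤ.+ t) (ℤP.+-identityʳ (- g x)) ⟩
      g x ℤ.+ - g x                    ≡⟨ ℤP.+-inverseʳ (g x) ⟩
      0ℤ                               ∎
      where
      zs : List A
      zs = without (f x) ys
      fx∈ys : f x ∈ ys
      fx∈ys with closed (here refl)
      ... | here fx≡x = ⊥-elim (fx≢x fx≡x)
      ... | there fx∈ys = fx∈ys
      sum-zs≡0 : sumℤ g zs ≡ 0ℤ
      sum-zs≡0 = sumℤ-involution-≤ n zs (ℕP.≤-trans (ListP.length-filter (λ z → ¬? (z ≟ f x)) ys) len)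
                   (UniqueP.filter⁺ (λ z → ¬? (z ≟ f x)) distinct) (closed-without x∉ys closed)
                   (reversing ∘ there ∘ proj₁ ∘ ∈-filter⁻ (λ z → ¬? (z ≟ f x)) {xs = ys})

  sumℤ-involution : ∀ {xs} → Unique xs → Closed xs → SignReversing xs → sumℤ g xs ≡ 0ℤ
  sumℤ-involution {xs} = sumℤ-involution-≤ (length xs) xs ℕP.≤-refl

∈-words⁻ : ∀ cs n {w} → w ∈ words cs n → All (_∈ cs) w × length w ≡ n
∈-words⁻ cs zero (here refl) = [] , refl
∈-words⁻ cs (suc n) w∈ with find (∈-concatMap⁻ (λ c → map (c ∷_) (words cs n)) {xs = cs} w∈)
... | c , c∈cs , w∈c∷ with ∈-map⁻ (c ∷_) w∈c∷
... | v , v∈ , refl with ∈-words⁻ cs n v∈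
... | letters , length≡ = c∈cs ∷ letters , cong suc length≡

∈-words⁺ : ∀ cs {w} → All (_∈ cs) w → w ∈ words cs (length w)
∈-words⁺ cs [] = here refl
∈-words⁺ cs {c ∷ w} (c∈cs ∷ letters) =
  ∈-concatMap⁺ (λ c → map (c ∷_) (words cs (length w))) (lose c∈cs (∈-map⁺ (c ∷_) (∈-words⁺ cs letters)))

words-unique : ∀ {cs} → Unique cs → ∀ n → Unique (words cs n)
words-unique u zero = [] ∷ []
words-unique {cs} u (suc n) = prefixed-unique cs u
  where
  prefixed : ℤ → List (List ℤ)
  prefixed c = map (c ∷_) (words cs n)
  prefixed-unique : ∀ ds → Unique ds → Unique (concatMap prefixed ds)
  prefixed-unique [] _ = []
  prefixed-unique (d ∷ ds) (d∉ds ∷ u′) =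
    UniqueP.++⁺ (UniqueP.map⁺ ListP.∷-injectiveʳ (words-unique u n)) (prefixed-unique ds u′) disjoint
    where
    disjoint : ∀ {v} → ¬ (v ∈ prefixed d × v ∈ concatMap prefixed ds)
    disjoint (v∈d , v∈ds) with ∈-map⁻ (d ∷_) v∈d | find (∈-concatMap⁻ prefixed {xs = ds} v∈ds)
    ... | _ , _ , refl | c , c∈ds , v∈c with ∈-map⁻ (c ∷_) v∈c
    ... | _ , _ , d∷≡c∷ = All.lookup d∉ds c∈ds (ListP.∷-injectiveˡ d∷≡c∷)

module _ {n} (a : Fin n → ℕ) where

  candidate-neg : ∀ {c} → c ∈ candidates a → - c ∈ candidates a
  candidate-neg c∈ with ∈-++⁻ (map +_ (aList a)) c∈
  ... | inj₁ c∈pos with ∈-map⁻ +_ c∈pos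
  ...   | t , t∈ , refl = ∈-++⁺ʳ (map +_ (aList a)) (∈-map⁺ (λ x → - (+ x)) t∈)
  candidate-neg c∈ | inj₂ c∈neg with ∈-map⁻ (λ x → - (+ x)) c∈neg
  ...   | t , t∈ , refl = subst (_∈ candidates a) (sym (ℤP.neg-involutive (+ t))) (∈-++⁺ˡ (∈-map⁺ +_ t∈))

  candidate-abs : ∀ {c} → c ∈ candidates a → ∃ λ i → ∣ c ∣ ≡ a i
  candidate-abs c∈ with ∈-++⁻ (map +_ (aList a)) c∈
  ... | inj₁ c∈pos with ∈-map⁻ +_ c∈pos
  ...   | t , t∈ , refl = ∈-tabulate⁻ t∈
  candidate-abs c∈ | inj₂ c∈neg with ∈-map⁻ (λ x → - (+ x)) c∈neg
  ...   | t , t∈ , refl with ∈-tabulate⁻ t∈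
  ...     | i , t≡ai = i , trans (ℤP.∣-i∣≡∣i∣ (+ t)) t≡ai

  candidates-unique : (∀ i → 0 < a i) → (∀ {i j} → a i ≡ a j → i ≡ j) → Unique (candidates a)
  candidates-unique positive injective =
    UniqueP.++⁺ (UniqueP.map⁺ ℤP.+-injective a-unique)
                (UniqueP.map⁺ (ℤP.+-injective ∘ ℤP.neg-injective) a-unique) disjoint
    where
    a-unique : Unique (aList a)
    a-unique = UniqueP.tabulate⁺ injective
    disjoint : ∀ {v} → ¬ (v ∈ map +_ (aList a) × v ∈ map (λ x → - (+ x)) (aList a))
    disjoint (v∈pos , v∈neg) with ∈-map⁻ +_ v∈pos | ∈-map⁻ (λ x → - (+ x)) v∈neg
    ... | _ , _ , refl | t , t∈ , +s≡-t with ∈-tabulate⁻ t∈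
    ... | i , refl with a i | positive i
    ... | suc _ | _ with +s≡-t
    ... | ()

min-∈ : ∀ {⊤ v vs} → v ≤ ⊤ → min ⊤ (v ∷ vs) ∈ v ∷ vs
min-∈ {⊤} {v} {vs} v≤⊤ with argmin-sel (λ x → x) ⊤ (v ∷ vs)
... | inj₂ min∈ = min∈
... | inj₁ min≡⊤ = here (ℕP.≤-antisym (All.head (min≤xs ⊤ (v ∷ vs))) (subst (v ≤_) (sym min≡⊤) v≤⊤))

AllPairs-++⁻ : ∀ {A : Set} {R : A → A → Set} xs {ys} → AllPairs R (xs ++ ys) →
               AllPairs R ys × All (λ x → All (R x) ys) xs
AllPairs-++⁻ [] Rys = Rys , []
AllPairs-++⁻ (x ∷ xs) (Rx ∷ Rxsys) with AllPairs-++⁻ xs Rxsys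
... | Rys , Rxsys′ = Rys , AllP.++⁻ʳ xs Rx ∷ Rxsys′

record SplitAt (M : ℕ) (w : List ℤ) : Set where
  field
    prefix : List ℤ
    pivot next : ℤ
    rest : List ℤ
    w≡ : w ≡ prefix ++ pivot ∷ next ∷ rest
    prefix-avoids : All (λ y → ∣ y ∣ ≢ M) prefix
    ∣pivot∣≡ : ∣ pivot ∣ ≡ M

posOf-∷-≡ : ∀ {M} y ys → ∣ y ∣ ≡ M → posOf M (y ∷ ys) ≡ 1
posOf-∷-≡ {M} y _ y≡M rewrite dec-true (∣ y ∣ ℕ.≟ M) y≡M = refl

posOf-∷-≢ : ∀ {M} y ys → ∣ y ∣ ≢ M → posOf M (y ∷ ys) ≡ suc (posOf M ys)
posOf-∷-≢ {M} y _ y≢M rewrite dec-false (∣ y ∣ ℕ.≟ M) y≢M = refl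

-- posOf returns length w when M does not occur, so posOf ≢ length w gives an occurrence that is not last.
splitAt : ∀ M w → posOf M w ≢ length w → SplitAt M w
splitAt M [] pos≢ = ⊥-elim (pos≢ refl)
splitAt M (y ∷ ys) pos≢ with ∣ y ∣ ℕ.≟ M
splitAt M (y ∷ []) pos≢ | yes y≡M = ⊥-elim (pos≢ (posOf-∷-≡ y [] y≡M))
splitAt M (y ∷ z ∷ zs) pos≢ | yes y≡M = record
  { prefix = [] ; pivot = y ; next = z ; rest = zs ; w≡ = refl ; prefix-avoids = [] ; ∣pivot∣≡ = y≡M }
splitAt M (y ∷ ys) pos≢ | no y≢M = record
  { prefix = y ∷ prefix ; pivot = pivot ; next = next ; rest = rest
  ; w≡ = cong (y ∷_) w≡ ; prefix-avoids = y≢M ∷ prefix-avoids ; ∣pivot∣≡ = ∣pivot∣≡ }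
  where open SplitAt (splitAt M ys (pos≢ ∘ trans (posOf-∷-≢ y ys y≢M) ∘ cong suc))

drop-posOf : ∀ {M ys x zs} → All (λ y → ∣ y ∣ ≢ M) ys → ∣ x ∣ ≡ M →
             drop (posOf M (ys ++ x ∷ zs)) (ys ++ x ∷ zs) ≡ zs
drop-posOf {M} {x = x} {zs} [] x≡M = cong (λ i → drop i (x ∷ zs)) (posOf-∷-≡ x zs x≡M)
drop-posOf {M} {y ∷ ys} {x} {zs} (y≢M ∷ ys≢M) x≡M =
  trans (cong (λ i → drop i (y ∷ ys ++ x ∷ zs)) (posOf-∷-≢ y (ys ++ x ∷ zs) y≢M)) (drop-posOf ys≢M x≡M)

term : ℕ → ℕ → ℕ → Monomial → ℤ
term d e k (c , d′ , e′ , k′) = if does (d ℕ.≟ d′) ∧ does (e ℕ.≟ e′) ∧ does (k ℕ.≟ k′) then c else 0ℤ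

term-neg : ∀ d e k c D E K → term d e k (- c , D , E , K) ≡ - term d e k (c , D , E , K)
term-neg d e k c D E K with does (d ℕ.≟ D) ∧ does (e ℕ.≟ E) ∧ does (k ℕ.≟ K)
... | true = refl
... | false = refl

coeff-map : ∀ {A : Set} (φ : A → Monomial) xs d e k → coeff (map φ xs) d e k ≡ sumℤ (term d e k ∘ φ) xs
coeff-map φ [] d e k = refl
coeff-map φ (x ∷ xs) d e k = cong (λ t → term d e k (φ x) ℤ.+ t) (coeff-map φ xs d e k)

module Involution (m : ℕ) (a : Fin (suc m) → ℕ)
                  (positive : ∀ i → 0 < a i) (increasing : ∀ i j → i <ᶠ j → a i < a j) where

  aₙ : ℕ
  aₙ = a (fromℕ m)

  a≤aₙ : ∀ i → a i ≤ aₙ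
  a≤aₙ i with ℕP.m≤n⇒m<n∨m≡n (FinP.≤fromℕ i)
  ... | inj₁ i<n = ℕP.<⇒≤ (increasing i (fromℕ m) i<n)
  ... | inj₂ i≡n = ℕP.≤-reflexive (cong a (FinP.toℕ-injective i≡n))

  a-injective : ∀ {i j} → a i ≡ a j → i ≡ j
  a-injective {i} {j} ai≡aj with FinP.<-cmp i j
  ... | tri< i<j _ _ = ⊥-elim (ℕP.<-irrefl ai≡aj (increasing i j i<j))
  ... | tri≈ _ i≡j _ = i≡j
  ... | tri> _ _ j<i = ⊥-elim (ℕP.<-irrefl (sym ai≡aj) (increasing j i j<i))

  letter-bounds : ∀ {c} → c ∈ candidates a → 0 < ∣ c ∣ × ∣ c ∣ ≤ aₙ
  letter-bounds c∈ with candidate-abs a c∈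
  ... | i , ∣c∣≡ai rewrite ∣c∣≡ai = positive i , a≤aₙ i

  Summands : List (List ℤ)
  Summands = filter (λ w → ¬? (posLast a w ℕ.≟ suc m)) (signedPerms (suc m) a)

  record Summand (w : List ℤ) : Set where
    field
      letters  : All (_∈ candidates a) w
      length≡  : length w ≡ suc m
      distinct : Unique (map ∣_∣ w)
      notLast  : posLast a w ≢ suc m

  ∈-Summands⁻ : ∀ {w} → w ∈ Summands → Summand w
  ∈-Summands⁻ w∈ with ∈-filter⁻ (λ w → ¬? (posLast a w ℕ.≟ suc m)) {xs = signedPerms (suc m) a} w∈
  ... | w∈perms , notLast with ∈-filter⁻ (λ w → unique? (map ∣_∣ w)) {xs = words (candidates a) (suc m)} w∈perms
  ... | w∈words , distinct with ∈-words⁻ (candidates a) (suc m) w∈words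
  ... | letters , length≡ =
    record { letters = letters ; length≡ = length≡ ; distinct = distinct ; notLast = notLast }

  ∈-Summands⁺ : ∀ {w} → Summand w → w ∈ Summands
  ∈-Summands⁺ {w} s =
    ∈-filter⁺ (λ w → ¬? (posLast a w ℕ.≟ suc m))
      (∈-filter⁺ (λ w → unique? (map ∣_∣ w))
        (subst (λ n → w ∈ words (candidates a) n) length≡ (∈-words⁺ (candidates a) letters)) distinct)
      notLast
    where open Summand s

  Summands-unique : Unique Summands
  Summands-unique =
    UniqueP.filter⁺ (λ w → ¬? (posLast a w ℕ.≟ suc m))
      (UniqueP.filter⁺ (λ w → unique? (map ∣_∣ w))
        (words-unique (candidates-unique a positive a-injective) (suc m)))

  toggle-Summand : ∀ k {w} → Summand w → Summand (map (toggle k) w)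
  toggle-Summand k {w} s = record
    { letters  = AllP.map⁺ (All.map toggle-candidate letters)
    ; length≡  = trans (ListP.length-map (toggle k) w) length≡
    ; distinct = subst Unique (sym (map-∣∣-toggle k w)) distinct
    ; notLast  = notLast ∘ trans (sym (posOf-toggle k aₙ w))
    }
    where
    open Summand s
    toggle-candidate : ∀ {c} → c ∈ candidates a → toggle k c ∈ candidates a
    toggle-candidate {c} c∈ with ∣ c ∣ ℕ.≟ k
    ... | yes c≡k = subst (_∈ candidates a) (sym (toggle-≡ c c≡k)) (candidate-neg a c∈)
    ... | no c≢k = subst (_∈ candidates a) (sym (toggle-≢ c c≢k)) c∈

  -- The default aₙ of min bounds every letter, so on a nonempty suffix the minimum is attained there.
  minAfter : List ℤ → ℕ
  minAfter w = min aₙ (map ∣_∣ (drop (posLast a w) w))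

  involution : List ℤ → List ℤ
  involution w = map (toggle (minAfter w)) w

  minAfter-toggle : ∀ k w → minAfter (map (toggle k) w) ≡ minAfter w
  minAfter-toggle k w = cong (min aₙ) (begin
    map ∣_∣ (drop (posLast a (map (toggle k) w)) (map (toggle k) w))
      ≡⟨ cong (λ i → map ∣_∣ (drop i (map (toggle k) w))) (posOf-toggle k aₙ w) ⟩
    map ∣_∣ (drop (posLast a w) (map (toggle k) w))
      ≡⟨ cong (map ∣_∣) (ListP.drop-map (posLast a w) w) ⟩
    map ∣_∣ (map (toggle k) (drop (posLast a w) w))
      ≡⟨ map-∣∣-toggle k (drop (posLast a w) w) ⟩
    map ∣_∣ (drop (posLast a w) w) ∎)

  involution-involutive : ∀ w → involution (involution w) ≡ w
  involution-involutive w = begin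
    map (toggle (minAfter (involution w))) (involution w)  ≡⟨ cong (λ k → map (toggle k) (involution w)) (minAfter-toggle (minAfter w) w) ⟩
    map (toggle (minAfter w)) (involution w)               ≡⟨ map-toggle-involutive (minAfter w) w ⟩
    w                                                      ∎

  module _ {w} (s : Summand w) where
    open Summand s
    private
      open SplitAt (splitAt aₙ w (λ pos≡length → notLast (trans pos≡length length≡)))

      μ : ℕ
      μ = minAfter w

      suffix : List ℤ
      suffix = next ∷ rest

      ∣w∣≡ : map ∣_∣ w ≡ map ∣_∣ prefix ++ map ∣_∣ (pivot ∷ suffix)
      ∣w∣≡ = trans (cong (map ∣_∣) w≡) (ListP.map-++ ∣_∣ prefix (pivot ∷ suffix))

      suffix-letters : All (_∈ candidates a) suffix
      suffix-letters = All.tail (AllP.++⁻ʳ prefix (subst (All (_∈ candidates a)) w≡ letters))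

      μ≡ : μ ≡ min aₙ (map ∣_∣ suffix)
      μ≡ = cong (min aₙ ∘ map ∣_∣) (trans (cong (λ v → drop (posOf aₙ v) v) w≡) (drop-posOf prefix-avoids ∣pivot∣≡))

      μ∈suffix : μ ∈ map ∣_∣ suffix
      μ∈suffix = subst (_∈ map ∣_∣ suffix) (sym μ≡) (min-∈ (proj₂ (letter-bounds (All.head suffix-letters))))

      μ≤suffix : All (λ y → μ ≤ ∣ y ∣) suffix
      μ≤suffix = AllP.map⁻ (subst (λ v → All (v ≤_) (map ∣_∣ suffix)) (sym μ≡) (min≤xs aₙ (map ∣_∣ suffix)))

      μ≤pivot : μ ≤ ∣ pivot ∣
      μ≤pivot = subst (μ ≤_) (sym ∣pivot∣≡) (subst (_≤ aₙ) (sym μ≡) (min≤⊤ aₙ (map ∣_∣ suffix)))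

      distinct-split : AllPairs _≢_ (map ∣_∣ (pivot ∷ suffix)) ×
                       All (λ u → All (u ≢_) (map ∣_∣ (pivot ∷ suffix))) (map ∣_∣ prefix)
      distinct-split = AllPairs-++⁻ (map ∣_∣ prefix) (subst Unique ∣w∣≡ distinct)

      prefix≢μ : All (λ y → ∣ y ∣ ≢ μ) prefix
      prefix≢μ = AllP.map⁻ (All.map (λ u≢ → All.lookup u≢ (there μ∈suffix)) (proj₂ distinct-split))

      pivot≢μ : ∣ pivot ∣ ≢ μ
      pivot≢μ = All.lookup (AllPairs.head (proj₁ distinct-split)) μ∈suffix

    minAfter≢0 : minAfter w ≢ 0
    minAfter≢0 μ≡0 = ℕP.<-irrefl (sym μ≡0) (All.lookup suffix-positive μ∈suffix)
      where
      suffix-positive : All (0 <_) (map ∣_∣ suffix)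
      suffix-positive = AllP.map⁺ (All.map (proj₁ ∘ letter-bounds) suffix-letters)

    minAfter-∈ : minAfter w ∈ map ∣_∣ w
    minAfter-∈ = subst (μ ∈_) (sym ∣w∣≡) (∈-++⁺ʳ (map ∣_∣ prefix) (there μ∈suffix))

    -- Left of ±μ lie only 0, the prefix and ±aₙ, none of absolute value μ; right of it only letters above μ.
    stable-minAfter : Linked (Stable (minAfter w)) (0ℤ ∷ w)
    stable-minAfter = subst (λ v → Linked (Stable μ) (0ℤ ∷ v)) (sym w≡)
      (stable-++ {ys = 0ℤ ∷ prefix} ((minAfter≢0 ∘ sym) ∷ prefix≢μ) pivot≢μ
        (stable-above (μ≤pivot ∷ μ≤suffix) (AllPairsP.map⁻ (proj₁ distinct-split))))

  monomial : List ℤ → Monomial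
  monomial w = -1ℤ ℤ.^ invB w , desB w , ascB w , posLast a w

  monomial-involution : ∀ {w} → Summand w →
                        monomial (involution w) ≡ (- (-1ℤ ℤ.^ invB w) , desB w , ascB w , posLast a w)
  monomial-involution {w} s =
    cong₂ _,_ (-1^-opposite (invB (involution w)) (invB w)
                (parity-invB-toggle w (minAfter≢0 s) (Summand.distinct s) (minAfter-∈ s)))
   (cong₂ _,_ (desB-toggle w (stable-minAfter s))
   (cong₂ _,_ (ascB-toggle w (stable-minAfter s))
              (posOf-toggle (minAfter w) aₙ w)))

lemma26 : (m : ℕ) (a : Fin (suc m) → ℕ)
    → (∀ i → 0 < a i)
    → (∀ i j → i <ᶠ j → a i < a j)
    → ∀ d e k → coeff (lemma26Poly m a) d e k ≡ 0ℤ
lemma26 m a positive increasing d e k = begin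
  coeff (lemma26Poly m a) d e k          ≡⟨ coeff-map monomial Summands d e k ⟩
  sumℤ (term d e k ∘ monomial) Summands  ≡⟨ sumℤ-involution (ListP.≡-dec ℤ._≟_) involution involution-involutive
                                              (term d e k ∘ monomial) Summands-unique
                                              (∈-Summands⁺ ∘ toggle-Summand _ ∘ ∈-Summands⁻) sign-reversing ⟩
  0ℤ                                     ∎
  where
  open Involution m a positive increasing
  sign-reversing : ∀ {w} → w ∈ Summands → term d e k (monomial (involution w)) ≡ - term d e k (monomial w)
  sign-reversing w∈ = trans (cong (term d e k) (monomial-involution (∈-Summands⁻ w∈))) (term-neg d e k _ _ _ _)
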